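{- Let $n \geq 1$ and let $\Pi \subseteq S_n$ be admissible and shift restricted. Then for every $m > n$ the word graph $G_m(\Pi)$ has directed diameter exactly $n$.
   Context: Word graphs: for $\Pi \subseteq S_n$, $m > n$ and a set $B$ with $|B| = m$, the word graph $G_m = G_m(\Pi)$ is the directed graph whose vertices are the words $x_1 \dots x_n$ over $B$ with pairwise distinct letters, with arcs $x_1 x_2 \dots x_n \to x_2 \dots x_n y$ for every $y \in B\setminus\{x_1,\dots,x_n\}$ and $x_1 \dots x_n \to x_{\pi(1)} \dots x_{\pi(n)}$ for every $\pi \in \Pi$. $\Pi$ is admissible if the directed diameter of $G_{4n}(\Pi)$ equals $n$. $\Pi$ is shift restricted if $\pi(i) \leq i+1$ for all $\pi \in \Pi$ and all $1 \leq i \leq n$. -}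

module Defs where

open import Data.Nat using (ℕ; zero; suc; _≤_; _<_; _*_)
open import Data.Fin using (Fin; toℕ)
open import Data.Fin.Permutation using (Permutation′; _⟨$⟩ʳ_)
open import Data.Vec using (Vec; []; _∷_; _∷ʳ_; lookup; tabulate)
open import Data.Vec.Membership.Propositional using (_∈_)
open import Data.Vec.Relation.Unary.Unique.Propositional using (Unique)
open import Data.List using (List)
import Data.List.Membership.Propositional as L
open import Data.Product using (Σ; ∃; ∃-syntax; _×_; proj₁)
open import Relation.Nullary using (¬_)
open import Relation.Binary.PropositionalEquality using (_≡_)

-- The alphabet B with |B| = m is taken to be Fin m (WLOG: only |B| matters).
-- A vertex of G_m: a word x₁…xₙ over Fin m with pairwise distinct letters.
Word : ℕ → ℕ → Set
Word m n = Σ (Vec (Fin m) n) Unique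

word : ∀ {m n} → Word m n → Vec (Fin m) n
word = proj₁

shiftIn : ∀ {m n} → Vec (Fin m) n → Fin m → Vec (Fin m) n
shiftIn []       y = []
shiftIn (x ∷ xs) y = xs ∷ʳ y

permute : ∀ {m n} → Permutation′ n → Vec (Fin m) n → Vec (Fin m) n
permute π x = tabulate (λ i → lookup x (π ⟨$⟩ʳ i))

data Arc {m n : ℕ} (Π : List (Permutation′ n)) (u v : Word m n) : Set where
  shift : ∀ (y : Fin m) → ¬ (y ∈ word u) → word v ≡ shiftIn (word u) y → Arc Π u v
  perm  : ∀ (π : Permutation′ n) → π L.∈ Π → word v ≡ permute π (word u) → Arc Π u v

-- Reach Π k u v : there is a directed walk of length at most k from u to v in G_m(Π).
data Reach {m n : ℕ} (Π : List (Permutation′ n)) : ℕ → Word m n → Word m n → Set where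
  here  : ∀ {k u v} → word u ≡ word v → Reach Π k u v
  step  : ∀ {k u w v} → Arc Π u w → Reach Π k w v → Reach Π (suc k) u v

HasDiameter : (m n : ℕ) → List (Permutation′ n) → ℕ → Set
HasDiameter m n Π d =
  ((u v : Word m n) → Reach Π d u v) ×
  (∃[ u ] ∃[ v ] ((k : ℕ) → k < d → ¬ Reach {m} Π k u v))

Admissible : (n : ℕ) → List (Permutation′ n) → Set
Admissible n Π = HasDiameter (4 * n) n Π n

-- π(i) ≤ i+1 (1-based), equivalently toℕ (π i) ≤ toℕ i + 1 (0-based).
ShiftRestricted : (n : ℕ) → List (Permutation′ n) → Set
ShiftRestricted n Π = ∀ π → π L.∈ Π → ∀ (i : Fin n) → toℕ (π ⟨$⟩ʳ i) ≤ suc (toℕ i)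

module Submission where

-- For a letter z and a word x let  pos z x  be the index of the
-- first occurrence of z in x (the length n of x if z does not occur).  Along a
-- shift arc every letter moves one place to the left, and along an arc of a
-- shift restricted permutation (π(i) ≤ i+1) a letter moves left by at most one
-- place; a letter can leave the word only from the front, by a shift.  Hence
--   * a walk from u to v has length ≥ pos z u − pos z v  for every letter z,
--     which for u = 1…n, v = 0…(n−1), z = 0 gives the lower bound n (this needs
--     only m > n);
--   * in a walk of length ≤ n a letter shifted in at the back is never shifted
--     out again, so every letter used by such a walk lies in its endpoints.
-- The second fact lets a walk of length ≤ n be relabelled along any map that is
-- injective on the letters of its endpoints.  Given u, v in G_m we compress the
-- ≤ 2n letters of u and v into an alphabet of size 4n, take the walk of length
-- ≤ n provided by admissibility, and relabel it back: this is the upper bound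
-- (valid for every m).

open import Defs
open import Data.Nat using (ℕ; zero; suc; _+_; _*_; _≤_; _<_; z≤n; s≤s; s≤s⁻¹)
open import Data.List using (List)
open import Data.Nat.Properties
  using (≤-refl; ≤-trans; ≤-reflexive; m≤m+n; m<m+n; n≤1+n; +-suc; +-monoʳ-<; <⇒≱; <-irrefl; m≤n⇒m<n∨m≡n; module ≤-Reasoning)
open import Data.Fin using (Fin; toℕ; inject≤; fromℕ<) renaming (zero to fz; suc to fs)
open import Data.Fin.Properties using (_≟_; toℕ-inject≤; toℕ-fromℕ<; inject≤-injective; suc-injective)
open import Data.Fin.Permutation using (Permutation′; _⟨$⟩ʳ_; _⟨$⟩ˡ_; inverseʳ)
open import Data.Vec using (Vec; []; _∷_; _∷ʳ_; _++_; lookup; tabulate; map; head)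
open import Data.Vec.Properties using (lookup∘tabulate; map-∷ʳ; lookup-map; tabulate-cong; tabulate-∘)
open import Data.Vec.Relation.Unary.All using (All; []; _∷_)
import Data.Vec.Relation.Unary.All as All
import Data.Vec.Relation.Unary.All.Properties as AllP
open import Data.Vec.Relation.Unary.Any using (here; there)
import Data.Vec.Relation.Unary.Any as Any
open import Data.Vec.Relation.Unary.Any.Properties using (lookup-index)
open import Data.Vec.Relation.Unary.AllPairs using ([]; _∷_)
open import Data.Vec.Relation.Unary.Unique.Propositional using (Unique)
import Data.Vec.Relation.Unary.Unique.Propositional.Properties as UniqueP
open import Data.Vec.Membership.Propositional using (_∈_)
open import Data.Vec.Membership.Propositional.Properties using (∈-lookup; ∈-++⁺ˡ; ∈-++⁺ʳ; ∈-tabulate⁺)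
import Data.Vec.Membership.DecPropositional as DecMembership
open import Data.Product using (Σ; ∃-syntax; _×_; _,_; proj₁; proj₂)
open import Data.Sum using (inj₁; inj₂)
open import Function using (_∘_; id)
open import Relation.Nullary using (¬_; yes; no; contradiction)
open import Relation.Binary.PropositionalEquality
  using (_≡_; _≢_; refl; sym; trans; cong; cong₂; subst; module ≡-Reasoning)

pos : ∀ {a k} → Fin a → Vec (Fin a) k → ℕ
pos z []       = 0
pos z (x ∷ xs) with z ≟ x
... | yes _ = 0
... | no  _ = suc (pos z xs)

pos≤length : ∀ {a k} (z : Fin a) (xs : Vec (Fin a) k) → pos z xs ≤ k
pos≤length z []       = z≤n
pos≤length z (x ∷ xs) with z ≟ x
... | yes _ = z≤n
... | no  _ = s≤s (pos≤length z xs)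

pos≤index : ∀ {a k} (z : Fin a) (xs : Vec (Fin a) k) (i : Fin k) →
  lookup xs i ≡ z → pos z xs ≤ toℕ i
pos≤index z (x ∷ xs) fz     x≡z with z ≟ x
... | yes _   = z≤n
... | no  z≢x = contradiction (sym x≡z) z≢x
pos≤index z (x ∷ xs) (fs i) xi≡z with z ≟ x
... | yes _ = z≤n
... | no  _ = s≤s (pos≤index z xs i xi≡z)

pos-occurrence : ∀ {a k} (z : Fin a) (xs : Vec (Fin a) k) → pos z xs < k →
  Σ (Fin k) λ i → toℕ i ≡ pos z xs × lookup xs i ≡ z
pos-occurrence z (x ∷ xs) p<k with z ≟ x
... | yes z≡x = fz , refl , sym z≡x
... | no  _ with pos-occurrence z xs (s≤s⁻¹ p<k)
...   | i , i≡p , xi≡z = fs i , cong suc i≡p , xi≡z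

pos-absent : ∀ {a k} (z : Fin a) (xs : Vec (Fin a) k) → ¬ z ∈ xs → pos z xs ≡ k
pos-absent z []       _   = refl
pos-absent z (x ∷ xs) z∉ with z ≟ x
... | yes z≡x = contradiction (here z≡x) z∉
... | no  _   = cong suc (pos-absent z xs (z∉ ∘ there))

pos-∷ʳ : ∀ {a k} (z y : Fin a) (xs : Vec (Fin a) k) → pos z xs ≤ pos z (xs ∷ʳ y)
pos-∷ʳ z y []       = z≤n
pos-∷ʳ z y (x ∷ xs) with z ≟ x
... | yes _ = z≤n
... | no  _ = s≤s (pos-∷ʳ z y xs)

pos-∷ʳ-new : ∀ {a k} (z : Fin a) (xs : Vec (Fin a) k) → ¬ z ∈ xs → pos z (xs ∷ʳ z) ≡ k
pos-∷ʳ-new z [] _ with z ≟ z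
... | yes _   = refl
... | no  z≢z = contradiction refl z≢z
pos-∷ʳ-new z (x ∷ xs) z∉ with z ≟ x
... | yes z≡x = contradiction (here z≡x) z∉
... | no  _   = cong suc (pos-∷ʳ-new z xs (z∉ ∘ there))

∈-∷ʳ⁺ : ∀ {A : Set} {k} {z y : A} {xs : Vec A k} → z ∈ xs → z ∈ xs ∷ʳ y
∈-∷ʳ⁺ (here z≡x) = here z≡x
∈-∷ʳ⁺ (there z∈) = there (∈-∷ʳ⁺ z∈)

∈-∷ʳ-new : ∀ {A : Set} {k} (y : A) (xs : Vec A k) → y ∈ xs ∷ʳ y
∈-∷ʳ-new y []       = here refl
∈-∷ʳ-new y (x ∷ xs) = there (∈-∷ʳ-new y xs)

All-∷ʳ : ∀ {A : Set} {P : A → Set} {k} {xs : Vec A k} {y : A} → All P xs → P y → All P (xs ∷ʳ y)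
All-∷ʳ []       py = py ∷ []
All-∷ʳ (p ∷ ps) py = p ∷ All-∷ʳ ps py

lookupOr : ∀ {A : Set} {k} → A → Vec A k → ℕ → A
lookupOr d []       _       = d
lookupOr d (x ∷ xs) zero    = x
lookupOr d (x ∷ xs) (suc i) = lookupOr d xs i

lookupOr-pos : ∀ {a k} (d z : Fin a) (xs : Vec (Fin a) k) → z ∈ xs → lookupOr d xs (pos z xs) ≡ z
lookupOr-pos d z (x ∷ xs) z∈ with z ≟ x
... | yes z≡x = sym z≡x
... | no  z≢x = lookupOr-pos d z xs (Any.tail z≢x z∈)

shiftIn-pos : ∀ {a k} (z y : Fin a) (xs : Vec (Fin a) k) → pos z xs ≤ suc (pos z (shiftIn xs y))
shiftIn-pos z y []       = z≤n
shiftIn-pos z y (x ∷ xs) with z ≟ x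
... | yes _ = z≤n
... | no  _ = s≤s (pos-∷ʳ z y xs)

shiftIn-leave : ∀ {a k} {z y : Fin a} (xs : Vec (Fin a) k) → z ∈ xs → ¬ z ∈ shiftIn xs y → pos z xs ≡ 0
shiftIn-leave {z = z} (x ∷ xs) z∈ z∉ with z ≟ x
... | yes _   = refl
... | no  z≢x = contradiction (∈-∷ʳ⁺ (Any.tail z≢x z∈)) z∉

shiftIn-new-pos : ∀ {a k} (y : Fin a) (xs : Vec (Fin a) (suc k)) → ¬ y ∈ xs → pos y (shiftIn xs y) ≡ k
shiftIn-new-pos y (x ∷ xs) y∉ = pos-∷ʳ-new y xs (y∉ ∘ there)

shiftIn-new-∈ : ∀ {a k} (y : Fin a) (xs : Vec (Fin a) (suc k)) → y ∈ shiftIn xs y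
shiftIn-new-∈ y (x ∷ xs) = ∈-∷ʳ-new y xs

All-shiftIn : ∀ {a k} {P : Fin a → Set} {xs : Vec (Fin a) k} {y : Fin a} → All P xs → P y → All P (shiftIn xs y)
All-shiftIn []       py = []
All-shiftIn (p ∷ ps) py = All-∷ʳ ps py

permute-pos : ∀ {a k} (π : Permutation′ k) → (∀ i → toℕ (π ⟨$⟩ʳ i) ≤ suc (toℕ i)) →
  (z : Fin a) (xs : Vec (Fin a) k) → pos z xs ≤ suc (pos z (permute π xs))
permute-pos {k = k} π restricted z xs with m≤n⇒m<n∨m≡n (pos≤length z (permute π xs))
... | inj₂ absent = ≤-trans (pos≤length z xs) (≤-trans (n≤1+n k) (s≤s (≤-reflexive (sym absent))))
... | inj₁ present with pos-occurrence z (permute π xs) present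
...   | i , i≡p , xπi≡z = begin
        pos z xs                    ≤⟨ pos≤index z xs (π ⟨$⟩ʳ i) (trans (sym (lookup∘tabulate _ i)) xπi≡z) ⟩
        toℕ (π ⟨$⟩ʳ i)              ≤⟨ restricted i ⟩
        suc (toℕ i)                 ≡⟨ cong suc i≡p ⟩
        suc (pos z (permute π xs))  ∎
  where open ≤-Reasoning

permute-∈ : ∀ {a k} (π : Permutation′ k) {z : Fin a} {xs : Vec (Fin a) k} → z ∈ xs → z ∈ permute π xs
permute-∈ π {z} {xs} z∈ = subst (_∈ permute π xs) moved (∈-tabulate⁺ (λ i → lookup xs (π ⟨$⟩ʳ i)) (π ⟨$⟩ˡ j))
  where
  j : Fin _
  j = Any.index z∈
  moved : lookup xs (π ⟨$⟩ʳ (π ⟨$⟩ˡ j)) ≡ z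
  moved = trans (cong (lookup xs) (inverseʳ π)) (sym (lookup-index z∈))

All-permute : ∀ {a k} {P : Fin a → Set} (π : Permutation′ k) {xs : Vec (Fin a) k} → All P xs → All P (permute π xs)
All-permute π ps = AllP.tabulate⁺ (λ i → AllP.lookup⁺ ps (π ⟨$⟩ʳ i))

arc-leave : ∀ {a n} {Π : List (Permutation′ n)} {z : Fin a} {u w : Word a n} →
  Arc Π u w → z ∈ word u → ¬ z ∈ word w → pos z (word u) ≡ 0
arc-leave {z = z} {u} (shift y _ e) z∈ z∉ = shiftIn-leave (word u) z∈ (subst (λ ws → ¬ z ∈ ws) e z∉)
arc-leave {z = z} (perm π _ e) z∈ z∉ = contradiction (subst (z ∈_) (sym e) (permute-∈ π z∈)) z∉

arc-congˡ : ∀ {a n} {Π : List (Permutation′ n)} {u u′ w : Word a n} → word u ≡ word u′ → Arc Π u w → Arc Π u′ w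
arc-congˡ u≡u′ (shift y y∉ e) = shift y (subst (λ ws → ¬ y ∈ ws) u≡u′ y∉) (trans e (cong (λ ws → shiftIn ws y) u≡u′))
arc-congˡ u≡u′ (perm π π∈Π e) = perm π π∈Π (trans e (cong (permute π) u≡u′))

reach-cong : ∀ {a n r} {Π : List (Permutation′ n)} {u u′ v v′ : Word a n} →
  word u ≡ word u′ → word v ≡ word v′ → Reach Π r u v → Reach Π r u′ v′
reach-cong u≡u′ v≡v′ (here u≡v)      = here (trans (sym u≡u′) (trans u≡v v≡v′))
reach-cong u≡u′ v≡v′ (step arc rest) = step (arc-congˡ u≡u′ arc) (reach-cong refl v≡v′ rest)

module Walks {a n : ℕ} {Π : List (Permutation′ n)} (SR : ShiftRestricted n Π) where

  open DecMembership {A = Fin a} _≟_ using (_∈?_)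

  arc-pos : (z : Fin a) {u w : Word a n} → Arc Π u w → pos z (word u) ≤ suc (pos z (word w))
  arc-pos z {u} (shift y _ e)    rewrite e = shiftIn-pos z y (word u)
  arc-pos z {u} (perm π π∈Π e) rewrite e = permute-pos π (SR π π∈Π) z (word u)

  reach-pos : (z : Fin a) {r : ℕ} {u v : Word a n} → Reach Π r u v → pos z (word u) ≤ pos z (word v) + r
  reach-pos z {r} (here u≡v) rewrite u≡v = m≤m+n _ r
  reach-pos z {suc r} {u} {v} (step {w = w} arc rest) = begin
    pos z (word u)            ≤⟨ arc-pos z arc ⟩
    suc (pos z (word w))      ≤⟨ s≤s (reach-pos z rest) ⟩
    suc (pos z (word v) + r)  ≡⟨ sym (+-suc _ r) ⟩
    pos z (word v) + suc r    ∎
    where open ≤-Reasoning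

  -- A letter leaving the word must first walk to the front: this takes more
  -- steps than its initial position.
  reach-leave : {z : Fin a} {r : ℕ} {u v : Word a n} → Reach Π r u v → z ∈ word u → ¬ z ∈ word v → pos z (word u) < r
  reach-leave {z} (here u≡v) z∈ z∉ = contradiction (subst (z ∈_) u≡v z∈) z∉
  reach-leave {z} (step {w = w} arc rest) z∈ z∉ with z ∈? word w
  ... | yes z∈w = s≤s (≤-trans (arc-pos z arc) (reach-leave rest z∈w z∉))
  ... | no  z∉w rewrite arc-leave arc z∈ z∉w = s≤s z≤n

  shifted-in-survives : {r : ℕ} {c : Fin a} {u w v : Word a n} →
    ¬ c ∈ word u → word w ≡ shiftIn (word u) c → Reach Π r w v → suc r ≤ n → c ∈ word v
  shifted-in-survives {c = c} {u} {w} {v} c∉u e rest (s≤s {n = k} r≤k) with c ∈? word v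
  ... | yes c∈v = c∈v
  ... | no  c∉v = contradiction (≤-trans (reach-leave rest c∈w c∉v) r≤k) (<-irrefl at-back)
    where
    at-back : pos c (word w) ≡ k
    at-back = trans (cong (pos c) e) (shiftIn-new-pos c (word u) c∉u)
    c∈w : c ∈ word w
    c∈w = subst (c ∈_) (sym e) (shiftIn-new-∈ c (word u))

map-shiftIn : ∀ {a b k} (f : Fin a → Fin b) (xs : Vec (Fin a) k) (y : Fin a) →
  map f (shiftIn xs y) ≡ shiftIn (map f xs) (f y)
map-shiftIn f []       y = refl
map-shiftIn f (x ∷ xs) y = map-∷ʳ f y xs

map-permute : ∀ {a b k} (f : Fin a → Fin b) (π : Permutation′ k) (xs : Vec (Fin a) k) →
  map f (permute π xs) ≡ permute π (map f xs)
map-permute f π xs = trans (sym (tabulate-∘ f _)) (tabulate-cong (λ i → sym (lookup-map (π ⟨$⟩ʳ i) f xs)))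

module Relabelling {a b : ℕ} (f : Fin a → Fin b) (g : Fin b → Fin a) (D : Fin a → Set)
                   (g∘f≡id : ∀ {x} → D x → g (f x) ≡ x) where

  f-injective : ∀ {x y} → D x → D y → f x ≡ f y → x ≡ y
  f-injective dx dy fx≡fy = trans (sym (g∘f≡id dx)) (trans (cong g fx≡fy) (g∘f≡id dy))

  map-unique : ∀ {k} {xs : Vec (Fin a) k} → All D xs → Unique xs → Unique (map f xs)
  map-unique []         []            = []
  map-unique (dx ∷ dxs) (x∉xs ∷ uniq) =
    AllP.map⁺ (All.map (λ { (x≢y , dy) → x≢y ∘ f-injective dx dy }) (All.zip (x∉xs , dxs)))
    ∷ map-unique dxs uniq

  map-∉ : ∀ {k} {y : Fin a} {xs : Vec (Fin a) k} → D y → All D xs → ¬ y ∈ xs → ¬ f y ∈ map f xs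
  map-∉ dy (dx ∷ dxs) y∉ (here fy≡fx) = y∉ (here (f-injective dy dx fy≡fx))
  map-∉ dy (dx ∷ dxs) y∉ (there fy∈) = map-∉ dy dxs (y∉ ∘ there) fy∈

  map-retract : ∀ {k} {xs : Vec (Fin a) k} → All D xs → map g (map f xs) ≡ xs
  map-retract []         = refl
  map-retract (dx ∷ dxs) = cong₂ _∷_ (g∘f≡id dx) (map-retract dxs)

  relabel : ∀ {n} (w : Word a n) → All D (word w) → Word b n
  relabel w dw = map f (word w) , map-unique dw (proj₂ w)

  -- A walk of length ≤ n whose endpoints have letters in D relabels to a walk:
  -- letters shifted in along the way survive to the end, so they lie in D too.
  relabel-reach : ∀ {n r} {Π : List (Permutation′ n)} → ShiftRestricted n Π →
    {w v : Word a n} (dw : All D (word w)) (dv : All D (word v)) →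
    r ≤ n → Reach Π r w v → Reach Π r (relabel w dw) (relabel v dv)
  relabel-reach SR dw dv _ (here w≡v) = here (cong (map f) w≡v)
  relabel-reach {Π = Π} SR {w} dw dv r≤n (step {w = w₂} (shift c c∉w e) rest) =
    step (shift (f c) (map-∉ dc dw c∉w) (trans (cong (map f) e) (map-shiftIn f (word w) c)))
         (relabel-reach SR dw₂ dv (≤-trans (n≤1+n _) r≤n) rest)
    where
    dc : D c
    dc = All.lookup dv (Walks.shifted-in-survives {a = a} {Π = Π} SR {u = w} c∉w e rest r≤n)
    dw₂ : All D (word w₂)
    dw₂ = subst (All D) (sym e) (All-shiftIn dw dc)
  relabel-reach SR {w} dw dv r≤n (step {w = w₂} (perm π π∈Π e) rest) =
    step (perm π π∈Π (trans (cong (map f) e) (map-permute f π (word w))))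
         (relabel-reach SR dw₂ dv (≤-trans (n≤1+n _) r≤n) rest)
    where
    dw₂ : All D (word w₂)
    dw₂ = subst (All D) (sym e) (All-permute π dw)

module Compression {m k a : ℕ} (Ls : Vec (Fin m) k) (d : Fin m) (k<a : k < a) where

  compress : Fin m → Fin a
  compress x = inject≤ (fromℕ< (s≤s (pos≤length x Ls))) k<a

  expand : Fin a → Fin m
  expand j = lookupOr d Ls (toℕ j)

  expand-compress : ∀ {x} → x ∈ Ls → expand (compress x) ≡ x
  expand-compress {x} x∈ = begin
    lookupOr d Ls (toℕ (compress x)) ≡⟨ cong (lookupOr d Ls) toℕ-compress ⟩
    lookupOr d Ls (pos x Ls)         ≡⟨ lookupOr-pos d x Ls x∈ ⟩
    x                                ∎
    where
    open ≡-Reasoning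
    toℕ-compress : toℕ (compress x) ≡ pos x Ls
    toℕ-compress = trans (toℕ-inject≤ _ k<a) (toℕ-fromℕ< _)

-- Upper bound: in G_m(Π) any two vertices are joined by a walk of length ≤ n,
-- obtained from the corresponding walk in G_4n(Π) after compressing u and v.
diameter-upper : ∀ (n : ℕ) {m : ℕ} {Π : List (Permutation′ (suc n))} →
  Admissible (suc n) Π → ShiftRestricted (suc n) Π → (u v : Word m (suc n)) → Reach Π (suc n) u v
diameter-upper n admissible SR u v =
  reach-cong (C.map-retract u∈Ls) (C.map-retract v∈Ls)
    (E.relabel-reach SR (fixed u∈Ls) (fixed v∈Ls) ≤-refl (proj₁ admissible u′ v′))
  where
  Ls : Vec _ (suc n + suc n)
  Ls = word u ++ word v
  twice<4times : suc n + suc n < 4 * suc n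
  twice<4times = +-monoʳ-< (suc n) (m<m+n (suc n) (s≤s z≤n))
  open Compression Ls (head (word u)) twice<4times
  module C = Relabelling compress expand (_∈ Ls) expand-compress
  module E = Relabelling expand compress (λ j → compress (expand j) ≡ j) id
  u∈Ls : All (_∈ Ls) (word u)
  u∈Ls = AllP.lookup⁻ (λ i → ∈-++⁺ˡ (∈-lookup i (word u)))
  v∈Ls : All (_∈ Ls) (word v)
  v∈Ls = AllP.lookup⁻ (λ i → ∈-++⁺ʳ (word u) (∈-lookup i (word v)))
  fixed : ∀ {xs : Vec _ (suc n)} → All (_∈ Ls) xs → All (λ j → compress (expand j) ≡ j) (map compress xs)
  fixed = AllP.map⁺ ∘ All.map (cong compress ∘ expand-compress)
  u′ v′ : Word (4 * suc n) (suc n)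
  u′ = C.relabel u u∈Ls
  v′ = C.relabel v v∈Ls

-- Lower bound: for m > n, reaching 0 1 … (n−1) from 1 2 … n takes n steps,
-- since the letter 0 enters at position n and must walk to position 0
-- (pos 0 v₀ = 0 holds by computation, so reach-pos reads n ≤ k).
diameter-lower : ∀ {n m : ℕ} {Π : List (Permutation′ (suc n))} → ShiftRestricted (suc n) Π → suc n < m →
  ∃[ u ] ∃[ v ] ((k : ℕ) → k < suc n → ¬ Reach {m} Π k u v)
diameter-lower {n} SR (s≤s n<m′) = u₀ , v₀ , λ k k<n walk →
  <⇒≱ k<n (subst (_≤ k) (pos-absent fz (word u₀) 0∉u₀) (Walks.reach-pos SR fz walk))
  where
  n≤m : suc n ≤ _
  n≤m = ≤-trans n<m′ (n≤1+n _)
  u₀ v₀ : Word _ (suc n)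
  u₀ = tabulate (λ i → fs (inject≤ i n<m′)) ,
       UniqueP.tabulate⁺ (λ {i} {j} e → inject≤-injective n<m′ n<m′ i j (suc-injective e))
  v₀ = tabulate (λ i → inject≤ i n≤m) , UniqueP.tabulate⁺ (λ {i} {j} → inject≤-injective n≤m n≤m i j)
  0∉u₀ : ¬ fz ∈ word u₀
  0∉u₀ 0∈ = All.lookup (AllP.tabulate⁺ {P = fz ≢_} {f = λ i → fs (inject≤ i n<m′)} (λ _ ())) 0∈ refl

mainTheorem6 : (n : ℕ) → 1 ≤ n → (Π : List (Permutation′ n)) →
    Admissible n Π → ShiftRestricted n Π →
    (m : ℕ) → n < m → HasDiameter m n Π n
mainTheorem6 (suc n) _ Π admissible SR m n<m = diameter-upper n admissible SR , diameter-lower SR n<m
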